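{- Let $G$ be a graph, let $L,d$ be positive integers with $d\ge 2$, and let $\ell_G\colon V(G)\to[L]$ be a complete layer assignment of $G$ with out-degree $d$. Then $$\sum_{v\in V(G)}\mathrm{NumPathsIn}_{G,\ell_G}(v)=\sum_{v\in V(G)}\mathrm{NumPathsOut}_{G,\ell_G}(v)\le |V(G)|\cdot\max_{v\in V(G)}\mathrm{NumPathsOut}_{G,\ell_G}(v)\le |V(G)|\cdot\sum_{j=0}^{L-1}d^j\le |V(G)|\cdot d^L.$$
   Context: $[L]=\{1,\dots,L\}$. A (complete) layer assignment of $G$ with $L$ layers and out-degree $d$ is a function $\ell\colon V(G)\to[L]$ such that for every $v$, $|\{u\in N_G(v):\ell(u)\ge\ell(v)\}|\le d$. A path $(v_1,\dots,v_k)$ in $G$ (with $k\ge1$; a single vertex is a path) is strictly increasing with respect to $\ell$ if $\ell(v_1)<\ell(v_2)<\dots<\ell(v_k)<\infty$. $\mathrm{NumPathsIn}_{G,\ell}(v)$ is the number of distinct strictly increasing paths ending at $v$, and $\mathrm{NumPathsOut}_{G,\ell}(v)$ is the number of distinct strictly increasing paths starting at $v$. -}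

module Defs where

open import Data.Nat using (ℕ; zero; suc; _+_; _*_; _^_; _≤_; _<_; _≥_; _⊔_; _<?_)
open import Data.Fin using (Fin)
open import Data.Fin.Properties using () renaming (_≟_ to _≟ᶠ_)
open import Data.List using (List; []; _∷_; map; concatMap; allFin; upTo; filter; length; foldr; head; last)
open import Data.Nat.ListAction using (sum)
open import Data.Maybe using (Maybe; just; nothing)
open import Data.Maybe.Properties using (≡-dec)
open import Data.Product using (_×_; _,_)
open import Relation.Nullary using (¬_; Dec; yes; no)
open import Relation.Nullary.Decidable using (_×-dec_)
open import Relation.Binary using (Decidable)
open import Relation.Binary.PropositionalEquality using (_≡_)

record Graph (n : ℕ) : Set₁ where
  field
    Adj    : Fin n → Fin n → Set
    adj?   : Decidable Adj
    sym    : ∀ {u v} → Adj u v → Adj v u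
    irrefl : ∀ {v} → ¬ Adj v v
open Graph public

module _ {n : ℕ} (G : Graph n) where

  N : Fin n → List (Fin n)
  N v = filter (λ u → adj? G v u) (allFin n)

  IsLayerAssignment : (L d : ℕ) → (Fin n → ℕ) → Set
  IsLayerAssignment L d ℓ =
    (∀ v → 1 ≤ ℓ v × ℓ v ≤ L) ×
    (∀ v → length (filter (λ u → ℓ v Data.Nat.≤? ℓ u) (N v)) ≤ d)

  data IncPath (ℓ : Fin n → ℕ) : List (Fin n) → Set where
    single : ∀ v → IncPath ℓ (v ∷ [])
    cons   : ∀ {u v vs} → Adj G u v → ℓ u < ℓ v → IncPath ℓ (v ∷ vs) → IncPath ℓ (u ∷ v ∷ vs)

  incPath? : (ℓ : Fin n → ℕ) → (p : List (Fin n)) → Dec (IncPath ℓ p)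
  incPath? ℓ [] = no (λ ())
  incPath? ℓ (v ∷ []) = yes (single v)
  incPath? ℓ (u ∷ v ∷ vs) with adj? G u v | ℓ u <? ℓ v | incPath? ℓ (v ∷ vs)
  ... | yes a | yes l | yes p = yes (cons a l p)
  ... | no ¬a | _ | _ = no λ { (cons a _ _) → ¬a a }
  ... | yes _ | no ¬l | _ = no λ { (cons _ l _) → ¬l l }
  ... | yes _ | yes _ | no ¬p = no λ { (cons _ _ p) → ¬p p }

  listsOfLength : ℕ → List (List (Fin n))
  listsOfLength zero = [] ∷ []
  listsOfLength (suc k) = concatMap (λ v → map (v ∷_) (listsOfLength k)) (allFin n)

  -- all vertex lists of length ≤ n; every strictly increasing path visits
  -- distinct vertices, hence has length ≤ n, so it occurs here exactly once
  candidates : List (List (Fin n))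
  candidates = concatMap listsOfLength (upTo (suc n))

  _≟ᴹ_ : (a b : Maybe (Fin n)) → Dec (a ≡ b)
  _≟ᴹ_ = ≡-dec _≟ᶠ_

  NumPathsIn : (ℓ : Fin n → ℕ) → Fin n → ℕ
  NumPathsIn ℓ v = length (filter (λ p → incPath? ℓ p ×-dec (last p ≟ᴹ just v)) candidates)

  NumPathsOut : (ℓ : Fin n → ℕ) → Fin n → ℕ
  NumPathsOut ℓ v = length (filter (λ p → incPath? ℓ p ×-dec (head p ≟ᴹ just v)) candidates)

-- Σ_{v ∈ V} f v and max_{v ∈ V} f v (max of the empty family is 0)
sumV : {n : ℕ} → (Fin n → ℕ) → ℕ
sumV {n} f = sum (map f (allFin n))

maxV : {n : ℕ} → (Fin n → ℕ) → ℕ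
maxV {n} f = foldr _⊔_ 0 (map f (allFin n))

geomSum : ℕ → ℕ → ℕ
geomSum d L = sum (map (d ^_) (upTo L))

{-# OPTIONS --safe #-}
module Submission where

-- Grouping the strictly increasing paths by their last and by their first vertex counts each
-- of them exactly once, whence the equality of the two sums. Call the neighbours u of v with
-- ℓ(u) ≥ ℓ(v) its out-neighbours; the layer condition says there are at most d of them. An
-- increasing path from v raises the layer at every step, so it takes at most L - ℓ(v) ≤ L - 1
-- steps, all to out-neighbours: it is one of the at most 1 + d + … + d^(L-1) walks of at most
-- L - 1 steps from v along out-neighbours. Finally 1 + d + … + d^(L-1) < d^L as d ≥ 2.

open import Defs
open import Algebra.Properties.CommutativeSemigroup using (interchange)
open import Data.Bool using (if_then_else_)
open import Data.Fin using (Fin; zero; suc)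
import Data.Fin.Properties as Fin
open import Data.List using (List; []; _∷_; _++_; tabulate; map; concatMap; allFin; upTo; applyUpTo; filter; length; foldr; head; last)
open import Data.List.Membership.Propositional using (_∈_)
open import Data.List.Membership.Propositional.Properties using (∈-map⁺; ∈-map⁻; ∈-concatMap⁺; ∈-concatMap⁻; ∈-filter⁺; ∈-filter⁻; ∈-allFin)
open import Data.List.Properties using (map-cong; map-applyUpTo; map-tabulate; length-map; length-tabulate; length-++; length-removeAt′; foldr-preservesᵇ; ∷-injectiveʳ)
open import Data.List.Relation.Binary.Subset.Propositional using (_⊆_)
open import Data.List.Relation.Unary.All as All using ()
open import Data.List.Relation.Unary.All.Properties as All using ()
open import Data.List.Relation.Unary.AllPairs as AllPairs using ()
open import Data.List.Relation.Unary.AllPairs.Properties as AllPairs using ()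
open import Data.List.Relation.Unary.Any as Any using (here; there; _─_)
open import Data.List.Relation.Unary.Unique.Propositional using (Unique)
open import Data.List.Relation.Unary.Unique.Propositional.Properties as Unique using ()
open import Data.Maybe using (Maybe; just)
open import Data.Maybe.Properties using (just-injective)
open import Data.Nat using (ℕ; zero; suc; _+_; _*_; _^_; _∸_; _≤_; _<_; _⊔_; z≤n; s≤s)
open import Data.Nat.ListAction using (sum)
open import Data.Nat.Properties
open import Data.Product using (_×_; _,_; ∃-syntax; proj₁; proj₂; uncurry)
open import Function using (_∘_)
open import Relation.Binary.Definitions using (DecidableEquality)
open import Relation.Binary.PropositionalEquality as ≡ using (_≡_; _≢_; refl; trans; cong; cong₂; module ≡-Reasoning)
open import Relation.Nullary using (Dec; ¬_; yes; no; does; contradiction)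
open import Relation.Nullary.Decidable using (_×-dec_; dec-true; dec-false)
open import Relation.Unary using (Pred; Decidable)

indicator : ∀ {p} {P : Set p} → Dec P → ℕ
indicator P? = if does P? then 1 else 0

indicator-yes : ∀ {p} {P : Set p} (P? : Dec P) → P → indicator P? ≡ 1
indicator-yes P? p = cong (if_then 1 else 0) (dec-true P? p)

indicator-no : ∀ {p} {P : Set p} (P? : Dec P) → ¬ P → indicator P? ≡ 0
indicator-no P? ¬p = cong (if_then 1 else 0) (dec-false P? ¬p)

length-filter-∷ : ∀ {a p} {A : Set a} {P : Pred A p} (P? : Decidable P) x xs →
  length (filter P? (x ∷ xs)) ≡ indicator (P? x) + length (filter P? xs)
length-filter-∷ P? x xs with P? x
... | yes _ = refl
... | no _ = refl

sum-map-+ : ∀ {a} {A : Set a} (f g : A → ℕ) xs →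
  sum (map (λ x → f x + g x) xs) ≡ sum (map f xs) + sum (map g xs)
sum-map-+ f g [] = refl
sum-map-+ f g (x ∷ xs) =
  trans (cong (f x + g x +_) (sum-map-+ f g xs)) (interchange +-commutativeSemigroup (f x) (g x) _ _)

sum≤length*max : ∀ xs → sum xs ≤ length xs * foldr _⊔_ 0 xs
sum≤length*max [] = z≤n
sum≤length*max (x ∷ xs) =
  +-mono-≤ (m≤m⊔n x _) (≤-trans (sum≤length*max xs) (*-monoʳ-≤ (length xs) (m≤n⊔m x _)))

module _ {a} {A : Set a} where

  ∈-─ : ∀ {x y : A} {ys} (x∈ys : x ∈ ys) → y ∈ ys → y ≢ x → y ∈ (ys ─ x∈ys)
  ∈-─ (here refl) (here refl) y≢x = contradiction refl y≢x
  ∈-─ (here _) (there y∈ys) _ = y∈ys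
  ∈-─ (there _) (here y≡z) _ = here y≡z
  ∈-─ (there x∈ys) (there y∈ys) y≢x = there (∈-─ x∈ys y∈ys y≢x)

  Unique-⊆⇒length≤ : ∀ {xs ys : List A} → Unique xs → xs ⊆ ys → length xs ≤ length ys
  Unique-⊆⇒length≤ {[]} _ _ = z≤n
  Unique-⊆⇒length≤ {x ∷ xs} {ys} (x∉xs AllPairs.∷ xs!) xs⊆ys = begin
    suc (length xs)              ≤⟨ s≤s (Unique-⊆⇒length≤ xs! xs⊆ys─x) ⟩
    suc (length (ys ─ x∈ys))     ≡⟨ length-removeAt′ ys (Any.index x∈ys) ⟨
    length ys                    ∎
    where
    open ≤-Reasoning
    x∈ys : x ∈ ys
    x∈ys = xs⊆ys (here refl)
    xs⊆ys─x : xs ⊆ (ys ─ x∈ys)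
    xs⊆ys─x y∈xs = ∈-─ x∈ys (xs⊆ys (there y∈xs)) (λ { refl → All.lookup x∉xs y∈xs refl })

module _ {a b} {A : Set a} {B : Set b} where

  Unique-concatMap⁺ : ∀ {f : A → List B} → (∀ x → Unique (f x)) →
    (∀ {x y e} → e ∈ f x → e ∈ f y → x ≡ y) →
    ∀ {xs} → Unique xs → Unique (concatMap f xs)
  Unique-concatMap⁺ f! separated {xs} xs! = Unique.concat⁺
    (All.map⁺ (All.universal f! xs))
    (AllPairs.map⁺ (AllPairs.map (λ x≢y {_} (e∈fx , e∈fy) → x≢y (separated e∈fx e∈fy)) xs!))

  length-concatMap≤ : ∀ (f : A → List B) {K} → (∀ x → length (f x) ≤ K) →
    ∀ xs → length (concatMap f xs) ≤ length xs * K
  length-concatMap≤ f bound [] = z≤n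
  length-concatMap≤ f {K} bound (x ∷ xs) = begin
    length (f x ++ concatMap f xs)          ≡⟨ length-++ (f x) ⟩
    length (f x) + length (concatMap f xs)  ≤⟨ +-mono-≤ (bound x) (length-concatMap≤ f bound xs) ⟩
    K + length xs * K                       ∎
    where open ≤-Reasoning

sumV-cong : ∀ {n} {f g : Fin n → ℕ} → (∀ v → f v ≡ g v) → sumV f ≡ sumV g
sumV-cong {n} f≗g = cong sum (map-cong f≗g (allFin n))

sumV-suc : ∀ {n} (f : Fin (suc n) → ℕ) → sumV f ≡ f zero + sumV (f ∘ suc)
sumV-suc {n} f = cong (f zero +_) (cong sum (begin
  map f (tabulate suc)        ≡⟨ map-tabulate suc f ⟩
  tabulate (f ∘ suc)          ≡⟨ map-tabulate (λ v → v) (f ∘ suc) ⟨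
  map (f ∘ suc) (allFin n)    ∎))
  where open ≡-Reasoning

sumV-zero : ∀ {n} {f : Fin n → ℕ} → (∀ v → f v ≡ 0) → sumV f ≡ 0
sumV-zero {zero} _ = refl
sumV-zero {suc n} {f} f≡0 = trans (sumV-suc f) (cong₂ _+_ (f≡0 zero) (sumV-zero (f≡0 ∘ suc)))

sumV-point : ∀ {n} {f : Fin n → ℕ} w → f w ≡ 1 → (∀ v → v ≢ w → f v ≡ 0) → sumV f ≡ 1
sumV-point {suc n} {f} zero fw≡1 f≡0 =
  trans (sumV-suc f) (cong₂ _+_ fw≡1 (sumV-zero (λ v → f≡0 (suc v) λ ())))
sumV-point {suc n} {f} (suc w) fw≡1 f≡0 =
  trans (sumV-suc f) (cong₂ _+_ (f≡0 zero λ ()) (sumV-point w fw≡1 λ v v≢w → f≡0 (suc v) (v≢w ∘ Fin.suc-injective)))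

sumV≤n*maxV : ∀ {n} (f : Fin n → ℕ) → sumV f ≤ n * maxV f
sumV≤n*maxV {n} f = begin
  sumV f                                  ≤⟨ sum≤length*max (map f (allFin n)) ⟩
  length (map f (allFin n)) * maxV f      ≡⟨ cong (_* maxV f) (trans (length-map f (allFin n)) (length-tabulate {n = n} (λ v → v))) ⟩
  n * maxV f                              ∎
  where open ≤-Reasoning

maxV≤ : ∀ {n} {f : Fin n → ℕ} {B} → (∀ v → f v ≤ B) → maxV f ≤ B
maxV≤ {n} {B = B} f≤B = foldr-preservesᵇ {P = _≤ B} ⊔-lub z≤n (All.map⁺ (All.universal f≤B (allFin n)))

module _ {a p} {A : Set a} {P : Pred A p} (P? : Decidable P) {n}
         (_≟_ : DecidableEquality (Maybe (Fin n))) (g : A → Maybe (Fin n))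
         (g-defined : ∀ {x} → P x → ∃[ w ] g x ≡ just w) where

  sumV-indicator-fibre : ∀ x → sumV (λ v → indicator (P? x ×-dec (g x ≟ just v))) ≡ indicator (P? x)
  sumV-indicator-fibre x with P? x
  ... | no _ = sumV-zero {n} (λ _ → refl)
  ... | yes px with g-defined px
  ... | w , gx≡w = sumV-point w (indicator-yes (g x ≟ just w) gx≡w)
    (λ v v≢w → indicator-no (g x ≟ just v) (λ gx≡v → v≢w (just-injective (trans (≡.sym gx≡v) gx≡w))))

  sumV-count-fibre : ∀ xs →
    sumV (λ v → length (filter (λ x → P? x ×-dec (g x ≟ just v)) xs)) ≡ length (filter P? xs)
  sumV-count-fibre [] = sumV-zero {n} (λ _ → refl)
  sumV-count-fibre (x ∷ xs) = begin
    sumV (λ v → length (filter (fibre? v) (x ∷ xs)))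
      ≡⟨ sumV-cong (λ v → length-filter-∷ (fibre? v) x xs) ⟩
    sumV (λ v → indicator (fibre? v x) + length (filter (fibre? v) xs))
      ≡⟨ sum-map-+ (λ v → indicator (fibre? v x)) (λ v → length (filter (fibre? v) xs)) (allFin n) ⟩
    sumV (λ v → indicator (fibre? v x)) + sumV (λ v → length (filter (fibre? v) xs))
      ≡⟨ cong₂ _+_ (sumV-indicator-fibre x) (sumV-count-fibre xs) ⟩
    indicator (P? x) + length (filter P? xs)
      ≡⟨ length-filter-∷ P? x xs ⟨
    length (filter P? (x ∷ xs)) ∎
    where
    open ≡-Reasoning
    fibre? : ∀ v → Decidable (λ x → P x × g x ≡ just v)
    fibre? v x = P? x ×-dec (g x ≟ just v)

sum-map-*ˡ : ∀ d xs → sum (map (d *_) xs) ≡ d * sum xs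
sum-map-*ˡ d [] = ≡.sym (*-zeroʳ d)
sum-map-*ˡ d (x ∷ xs) = trans (cong (d * x +_) (sum-map-*ˡ d xs)) (≡.sym (*-distribˡ-+ d x (sum xs)))

geomSum-suc : ∀ d k → geomSum d (suc k) ≡ 1 + d * geomSum d k
geomSum-suc d k = cong suc (begin
  sum (map (d ^_) (applyUpTo suc k))           ≡⟨ cong sum (map-applyUpTo suc (d ^_) k) ⟩
  sum (applyUpTo (λ i → d * d ^ i) k)          ≡⟨ cong sum (map-applyUpTo (d ^_) (d *_) k) ⟨
  sum (map (d *_) (applyUpTo (d ^_) k))        ≡⟨ cong (sum ∘ map (d *_)) (map-applyUpTo (λ i → i) (d ^_) k) ⟨
  sum (map (d *_) (map (d ^_) (upTo k)))       ≡⟨ sum-map-*ˡ d (map (d ^_) (upTo k)) ⟩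
  d * geomSum d k                              ∎)
  where open ≡-Reasoning

geomSum<pow : ∀ {d} → 2 ≤ d → ∀ k → geomSum d k < d ^ k
geomSum<pow d≥2 zero = s≤s z≤n
geomSum<pow {d} d≥2 (suc k) = begin-strict
  geomSum d (suc k)  ≡⟨ geomSum-suc d k ⟩
  1 + d * g          <⟨ +-monoˡ-< (d * g) d≥2 ⟩
  d + d * g          ≡⟨ *-suc d g ⟨
  d * suc g          ≤⟨ *-monoʳ-≤ d (geomSum<pow d≥2 k) ⟩
  d * d ^ k          ∎
  where
  open ≤-Reasoning
  g = geomSum d k

module Walks {a} {A : Set a} (next : A → List A) where

  walks : ℕ → A → List (List A)
  walks zero v = (v ∷ []) ∷ []
  walks (suc k) v = (v ∷ []) ∷ concatMap (λ w → map (v ∷_) (walks k w)) (next v)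

  length-walks : ∀ {d} → (∀ v → length (next v) ≤ d) → ∀ k v → length (walks k v) ≤ geomSum d (suc k)
  length-walks bound zero v = ≤-refl
  length-walks {d} bound (suc k) v = begin
    suc (length (concatMap (λ w → map (v ∷_) (walks k w)) (next v)))
      ≤⟨ s≤s (length-concatMap≤ (λ w → map (v ∷_) (walks k w)) extend-bound (next v)) ⟩
    suc (length (next v) * geomSum d (suc k))
      ≤⟨ s≤s (*-monoˡ-≤ (geomSum d (suc k)) (bound v)) ⟩
    suc (d * geomSum d (suc k))
      ≡⟨ geomSum-suc d (suc k) ⟨
    geomSum d (suc (suc k)) ∎
    where
    open ≤-Reasoning
    extend-bound : ∀ w → length (map (v ∷_) (walks k w)) ≤ geomSum d (suc k)
    extend-bound w = ≤-trans (≤-reflexive (length-map (v ∷_) (walks k w))) (length-walks bound k w)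

module _ {n} (G : Graph n) where

  incPath-head : ∀ {ℓ p} → IncPath G ℓ p → ∃[ v ] head p ≡ just v
  incPath-head (single v) = v , refl
  incPath-head (cons {u} _ _ _) = u , refl

  incPath-last : ∀ {ℓ p} → IncPath G ℓ p → ∃[ v ] last p ≡ just v
  incPath-last (single v) = v , refl
  incPath-last (cons _ _ path) = incPath-last path

  ∈-listsOfLength⇒length : ∀ k {e} → e ∈ listsOfLength G k → length e ≡ k
  ∈-listsOfLength⇒length zero (here refl) = refl
  ∈-listsOfLength⇒length (suc k) e∈
    with v , e∈′ ← Any.satisfied (∈-concatMap⁻ (λ v → map (v ∷_) (listsOfLength G k)) {xs = allFin n} e∈)
    with _ , es∈ , refl ← ∈-map⁻ (v ∷_) e∈′
    = cong suc (∈-listsOfLength⇒length k es∈)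

  listsOfLength-Unique : ∀ k → Unique (listsOfLength G k)
  listsOfLength-Unique zero = All.[] AllPairs.∷ AllPairs.[]
  listsOfLength-Unique (suc k) =
    Unique-concatMap⁺ (λ _ → Unique.map⁺ ∷-injectiveʳ (listsOfLength-Unique k)) same-head (Unique.allFin⁺ n)
    where
    same-head : ∀ {v w e} → e ∈ map (v ∷_) (listsOfLength G k) → e ∈ map (w ∷_) (listsOfLength G k) → v ≡ w
    same-head e∈ e∈′ with ∈-map⁻ _ e∈ | ∈-map⁻ _ e∈′
    ... | _ , _ , refl | _ , _ , refl = refl

  candidates-Unique : Unique (candidates G)
  candidates-Unique = Unique-concatMap⁺ listsOfLength-Unique same-length (Unique.upTo⁺ (suc n))
    where
    same-length : ∀ {k k′ e} → e ∈ listsOfLength G k → e ∈ listsOfLength G k′ → k ≡ k′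
    same-length e∈ e∈′ = trans (≡.sym (∈-listsOfLength⇒length _ e∈)) (∈-listsOfLength⇒length _ e∈′)

  module _ (ℓ : Fin n → ℕ) where

    -- ≤ rather than <: these are exactly the neighbours bounded by the out-degree condition.
    outNeighbours : Fin n → List (Fin n)
    outNeighbours v = filter (λ u → ℓ v ≤? ℓ u) (N G v)

    open Walks outNeighbours

    incPath∈walks : ∀ {L} → (∀ v → ℓ v ≤ L) →
      ∀ {v vs} → IncPath G ℓ (v ∷ vs) → ∀ {k} → L ∸ ℓ v ≤ k → v ∷ vs ∈ walks k v
    incPath∈walks _ (single v) {zero} _ = here refl
    incPath∈walks _ (single v) {suc k} _ = here refl
    incPath∈walks ℓ≤L {u} (cons {v = w} u~w ℓu<ℓw path) L∸ℓu≤k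
      with s≤s L∸ℓw≤k ← ≤-trans (∸-monoʳ-< ℓu<ℓw (ℓ≤L w)) L∸ℓu≤k
      = there (∈-concatMap⁺ (λ x → map (u ∷_) (walks _ x))
                (Any.map (λ { refl → ∈-map⁺ (u ∷_) (incPath∈walks ℓ≤L path L∸ℓw≤k) }) w∈out))
      where
      w∈out : w ∈ outNeighbours u
      w∈out = ∈-filter⁺ (λ x → ℓ u ≤? ℓ x) (∈-filter⁺ (adj? G u) (∈-allFin w) u~w) (<⇒≤ ℓu<ℓw)

    NumPathsOut≤geomSum : ∀ {L d} → IsLayerAssignment G L d ℓ → ∀ v → NumPathsOut G ℓ v ≤ geomSum d L
    NumPathsOut≤geomSum {zero} (layers , _) v = contradiction (uncurry ≤-trans (layers v)) λ ()
    NumPathsOut≤geomSum {suc L} {d} (layers , outdeg) v = begin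
      NumPathsOut G ℓ v   ≤⟨ Unique-⊆⇒length≤ (Unique.filter⁺ starts-at-v? candidates-Unique) paths⊆walks ⟩
      length (walks L v)  ≤⟨ length-walks outdeg L v ⟩
      geomSum d (suc L)   ∎
      where
      open ≤-Reasoning
      starts-at-v? : Decidable (λ p → IncPath G ℓ p × head p ≡ just v)
      starts-at-v? p = incPath? G ℓ p ×-dec (_≟ᴹ_ G (head p) (just v))
      paths⊆walks : filter starts-at-v? (candidates G) ⊆ walks L v
      paths⊆walks p∈ with ∈-filter⁻ starts-at-v? {xs = candidates G} p∈
      paths⊆walks {u ∷ _} _ | _ , path , refl =
        incPath∈walks (proj₂ ∘ layers) path (∸-monoʳ-≤ (suc L) (proj₁ (layers u)))

mainTheorem4 : (n : ℕ) (G : Graph n) (L d : ℕ) → 1 ≤ L → 2 ≤ d →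
    (ℓ : Fin n → ℕ) → IsLayerAssignment G L d ℓ →
      (sumV (NumPathsIn G ℓ) ≡ sumV (NumPathsOut G ℓ)) ×
      (sumV (NumPathsOut G ℓ) ≤ n * maxV (NumPathsOut G ℓ)) ×
      (n * maxV (NumPathsOut G ℓ) ≤ n * geomSum d L) ×
      (n * geomSum d L ≤ n * d ^ L)
mainTheorem4 n G L d _ d≥2 ℓ layered =
  trans (sumV-count-fibre (incPath? G ℓ) (_≟ᴹ_ G) last (incPath-last G) (candidates G))
        (≡.sym (sumV-count-fibre (incPath? G ℓ) (_≟ᴹ_ G) head (incPath-head G) (candidates G))) ,
  sumV≤n*maxV (NumPathsOut G ℓ) ,
  *-monoʳ-≤ n (maxV≤ (NumPathsOut≤geomSum G ℓ layered)) ,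
  *-monoʳ-≤ n (<⇒≤ (geomSum<pow d≥2 L))
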